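{- Let $i\ne j$ and let $F=L(x_i,x_j)/(1-x_i/x_j)^m$, where $L(x_i,x_j)$ is a homogeneous Laurent polynomial in $x_i,x_j$ of degree $0$ with coefficients in $\mathbb{C}$ and $m$ is a nonnegative integer. Then $[i,j]F=-[j,i]F\in\mathbb{C}$.
   Context: For $a\ne b$ and a rational function $F$ whose denominator is a product of factors $(1-x_a/x_u)$ or $(1-x_u/x_a)$, view $F$ as a rational function of $x_a$ (rewriting $1-x_u/x_a=-(x_u/x_a)(1-x_a/x_u)$) and take its partial fraction decomposition with respect to $x_a$: $F=L_1(x_a)+\sum_{u}A_u(x_a)/(1-x_a/x_u)^{q_u}$, with $L_1$ a Laurent polynomial in $x_a$ and $A_u$ a polynomial in $x_a$ of degree $<q_u$ (coefficients depending on the other variables). Define $[a,b]F=\mathrm{CT}_{x_a=x_b}F:=A_b(0)$, and $[a,b]F=0$ if $x_a=x_b$ is not a pole of $F$. -}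

module Defs where

open import Level using (_⊔_)
open import Algebra.Bundles using (CommutativeRing)
open import Data.Bool using (Bool; true; false; if_then_else_; _∧_)
open import Data.Integer as ℤ using (ℤ; +_; -[1+_])
open import Data.Nat as ℕ using (ℕ; zero; suc)
open import Data.List using (List; []; _∷_; _++_; map; concatMap)
open import Data.Product using (Σ; _×_; _,_; ∃)
open import Relation.Nullary using (¬_)
open import Relation.Nullary.Decidable using (does)
open import Relation.Binary.PropositionalEquality using (_≢_)

-- The two variables x_i and x_j (i ≠ j).  Only these two occur in F.
data Var : Set where
  vi vj : Var

-- the other variable (so that [a , other a] ranges over [i,j] and [j,i])
other : Var → Var
other vi = vj
other vj = vi

module LaurentPoly {c ℓ} (R : CommutativeRing c ℓ) where
  open CommutativeRing R

  -- a term  r · x_i^e · x_j^f  is stored as (r , e , f)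
  Term : Set c
  Term = Carrier × ℤ × ℤ

  LP : Set c
  LP = List Term

  _==_ : ℤ → ℤ → Bool
  e == f = does (e ℤ.≟ f)

  coeff : LP → ℤ → ℤ → Carrier
  coeff [] e f = 0#
  coeff ((r , a , b) ∷ p) e f =
    (if ((a == e) ∧ (b == f)) then r else 0#) + coeff p e f

  _≋_ : LP → LP → Set ℓ
  p ≋ q = ∀ e f → coeff p e f ≈ coeff q e f

  _⊕_ : LP → LP → LP
  p ⊕ q = p ++ q

  _⊗_ : LP → LP → LP
  p ⊗ q = concatMap (λ { (r , a , b) →
            map (λ { (s , a′ , b′) → (r * s , a ℤ.+ a′ , b ℤ.+ b′) }) q }) p

  one : LP
  one = (1# , + 0 , + 0) ∷ []

  _^^_ : LP → ℕ → LP
  p ^^ zero = one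
  p ^^ suc n = p ⊗ (p ^^ n)

  expOf : Var → ℤ → ℤ → ℤ
  expOf vi e f = e
  expOf vj e f = f

  -- the factor  1 - x_a / x_b  with b = other a
  oneMinus : Var → LP
  oneMinus vi = (1# , + 0 , + 0) ∷ (- 1# , + 1 , -[1+ 0 ]) ∷ []
  oneMinus vj = (1# , + 0 , + 0) ∷ (- 1# , -[1+ 0 ] , + 1) ∷ []

  IsHomogeneousDeg0 : LP → Set ℓ
  IsHomogeneousDeg0 L = ∀ e f → e ℤ.+ f ≢ + 0 → coeff L e f ≈ 0#

  IsPolyDegLt : Var → LP → ℕ → Set ℓ
  IsPolyDegLt a A q =
    ∀ e f → ¬ ((+ 0 ℤ.≤ expOf a e f) × (expOf a e f ℤ.< + q)) → coeff A e f ≈ 0#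

  -- F = N / (1 - x_i/x_j)^m.  A partial fraction decomposition of F with respect
  -- to x_a (pole at x_a = x_b, b = other a):  F = L1 + A / (1 - x_a/x_b)^q,
  -- L1 Laurent in x_a, A polynomial in x_a of degree < q.  The identity of
  -- rational functions is stated after clearing denominators:
  --   N · (1 - x_a/x_b)^q = (L1 · (1 - x_a/x_b)^q + A) · (1 - x_i/x_j)^m.
  IsPartialFraction : Var → LP → ℕ → LP → LP → ℕ → Set ℓ
  IsPartialFraction a N m L1 A q =
    IsPolyDegLt a A q ×
    ((N ⊗ (oneMinus a ^^ q)) ≋ (((L1 ⊗ (oneMinus a ^^ q)) ⊕ A) ⊗ (oneMinus vi ^^ m)))

  -- coefficient of x_b^f in A(0)  (A evaluated at x_a = 0), b = other a
  ct : Var → LP → ℤ → Carrier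
  ct vi A f = coeff A (+ 0) f
  ct vj A f = coeff A f (+ 0)

  HasPartialFraction : Var → LP → ℕ → Set (c ⊔ ℓ)
  HasPartialFraction a N m = Σ LP λ L1 → Σ LP λ A → Σ ℕ λ q → IsPartialFraction a N m L1 A q

  -- [a, other a] F = v, where v : ℤ → Carrier lists the coefficients of the
  -- Laurent polynomial (in the other variable) A(0), for every decomposition
  BracketIs : Var → LP → ℕ → (ℤ → Carrier) → Set (c ⊔ ℓ)
  BracketIs a N m v =
    ∀ L1 A q → IsPartialFraction a N m L1 A q → ∀ f → ct a A f ≈ v f

  const : Carrier → ℤ → Carrier
  const r f = if (f == (ℤ.+ 0)) then r else 0#

{-# OPTIONS --safe #-}
module Submission where

-- The bracket [a,b] is computed by a linear functional.  Pair a Laurent polynomial,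
-- on the slice of total degree d, with the weight P_k(exponent of x_a), where
-- P_k(x) = (-1)^(k-1) binom(x-1, k-1).  Multiplication by 1 - x_a/x_b is adjoint to a
-- difference operator that lowers k by one, and P_k vanishes at 1, …, k-1 with
-- P_k(0) = 1; so the pairing annihilates (1 - x_a/x_b)^k L₁ and returns A(0) for every A
-- of degree < k in x_a.  Hence A(0) is determined by L in every decomposition, and it
-- vanishes outside degree 0 when L is homogeneous of degree 0.  For [j,i] one writes
-- 1 - x_i/x_j = -(x_i/x_j)(1 - x_j/x_i), and the reflection (-1)^m P_m(b+m) = -P_m(-b)
-- turns the value of [j,i]F into minus that of [i,j]F.  The decompositions exist by
-- m-fold Euclidean division by 1 - x_a/x_b.

open import Defs
open import Algebra.Bundles using (CommutativeRing)
open import Data.Nat using (ℕ)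
open import Data.Product using (Σ; _×_)

open import Level using (_⊔_)
open import Data.Bool using (true; false; if_then_else_; _∧_)
import Data.Bool.Properties as BoolP
open import Data.Empty using (⊥-elim)
open import Data.Integer as ℤ using (ℤ; +_; -[1+_]; ∣_∣)
import Data.Integer.Properties as ℤP
import Data.Integer.Tactic.RingSolver as ℤ-Solver
open import Data.List using ([]; _∷_; _++_; map)
open import Data.Maybe using (nothing)
open import Data.Nat as ℕ using (zero; suc; z≤n; s≤s)
import Data.Nat.Properties as ℕP
open import Data.Product using (_,_; proj₁; proj₂)
open import Data.Sum using (inj₁; inj₂)
open import Relation.Nullary using (¬_; yes; no)
open import Relation.Binary.PropositionalEquality as ≡ using (_≡_; _≢_; refl; cong; cong₂)
import Tactic.RingSolver as Ring-Solver
import Tactic.RingSolver.Core.AlmostCommutativeRing as ACR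

module PartialFractions {c ℓ} (R : CommutativeRing c ℓ) where

  module SolverIdentities where
    solverRing : ACR.AlmostCommutativeRing c ℓ
    solverRing = ACR.fromCommutativeRing R (λ _ → nothing)
    open ACR.AlmostCommutativeRing solverRing

    [x+y]+[z+w]≈[x+z]+[y+w] : ∀ x y z w → (x + y) + (z + w) ≈ (x + z) + (y + w)
    [x+y]+[z+w]≈[x+z]+[y+w] = Ring-Solver.solve-∀ solverRing

    [x+y]-[z+w]≈[x-z]+[y-w] : ∀ x y z w → (x + y) - (z + w) ≈ (x - z) + (y - w)
    [x+y]-[z+w]≈[x-z]+[y-w] = Ring-Solver.solve-∀ solverRing

    [x-y]-[z-w]≈[x-z]-[y-w] : ∀ x y z w → (x - y) - (z - w) ≈ (x - z) - (y - w)
    [x-y]-[z-w]≈[x-z]-[y-w] = Ring-Solver.solve-∀ solverRing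

    x*[y*z]≈y*[x*z] : ∀ x y z → x * (y * z) ≈ y * (x * z)
    x*[y*z]≈y*[x*z] = Ring-Solver.solve-∀ solverRing

  open SolverIdentities
  open CommutativeRing R hiding (zero)
    renaming (refl to ≈-refl; sym to ≈-sym; trans to ≈-trans; reflexive to ≈-reflexive)
  open import Algebra.Properties.Ring ring
    using (-0#≈0#; -‿involutive; -‿+-comm; -‿distribˡ-*; -‿distribʳ-*; x[y-z]≈xy-xz; -1*x≈-x)
  open LaurentPoly R
  open import Relation.Binary.Reasoning.Setoid setoid

  0+0≈0 : 0# + 0# ≈ 0#
  0+0≈0 = +-identityʳ 0#

  x-x≈0 : ∀ x → x - x ≈ 0#
  x-x≈0 = -‿inverseʳ

  x+y-y≈x : ∀ x y → (x + y) - y ≈ x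
  x+y-y≈x x y = ≈-trans (+-assoc x y (- y)) (≈-trans (+-congˡ (-‿inverseʳ y)) (+-identityʳ x))

  x-y+y≈x : ∀ x y → (x - y) + y ≈ x
  x-y+y≈x x y = ≈-trans (+-assoc x (- y) y) (≈-trans (+-congˡ (-‿inverseˡ y)) (+-identityʳ x))

  x-[x-y]≈y : ∀ x y → x - (x - y) ≈ y
  x-[x-y]≈y x y = begin
    x + - (x - y)      ≈⟨ +-congˡ (≈-sym (-‿+-comm x (- y))) ⟩
    x + (- x + - - y)  ≈⟨ ≈-sym (+-assoc x (- x) _) ⟩
    (x - x) + - - y    ≈⟨ +-cong (x-x≈0 x) (-‿involutive y) ⟩
    0# + y             ≈⟨ +-identityˡ y ⟩
    y                  ∎

  x-y≈-[y-x] : ∀ x y → x - y ≈ - (y - x)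
  x-y≈-[y-x] x y = ≈-sym (begin
    - (y - x)     ≈⟨ ≈-sym (-‿+-comm y (- x)) ⟩
    - y + - - x   ≈⟨ +-congˡ (-‿involutive x) ⟩
    - y + x       ≈⟨ +-comm (- y) x ⟩
    x - y         ∎)

  -x--y≈y-x : ∀ x y → - x - - y ≈ y - x
  -x--y≈y-x x y = ≈-trans (+-congˡ (-‿involutive y)) (+-comm (- x) y)

  -x*-y≈x*y : ∀ x y → (- x) * (- y) ≈ x * y
  -x*-y≈x*y x y = begin
    - x * - y      ≈⟨ ≈-sym (-‿distribˡ-* x (- y)) ⟩
    - (x * - y)    ≈⟨ -‿cong (≈-sym (-‿distribʳ-* x y)) ⟩
    - - (x * y)    ≈⟨ -‿involutive _ ⟩
    x * y          ∎

  ==-refl : ∀ x → (x == x) ≡ true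
  ==-refl x with x ℤ.≟ x
  ... | yes _ = refl
  ... | no x≢x = ⊥-elim (x≢x refl)

  ==-false : ∀ {x y} → x ≢ y → (x == y) ≡ false
  ==-false {x} {y} x≢y with x ℤ.≟ y
  ... | yes x≡y = ⊥-elim (x≢y x≡y)
  ... | no _ = refl

  ==-cong-iff : ∀ {x y x′ y′} → (x ≡ y → x′ ≡ y′) → (x′ ≡ y′ → x ≡ y) → (x == y) ≡ (x′ == y′)
  ==-cong-iff {x} {y} {x′} {y′} to from with x ℤ.≟ y | x′ ℤ.≟ y′
  ... | yes _ | yes _ = refl
  ... | no _ | no _ = refl
  ... | yes x≡y | no x′≢y′ = ⊥-elim (x′≢y′ (to x≡y))
  ... | no x≢y | yes x′≡y′ = ⊥-elim (x≢y (from x′≡y′))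

  ==-shift : ∀ a x y → ((a ℤ.+ x) == y) ≡ (x == (y ℤ.- a))
  ==-shift a x y = ==-cong-iff (λ a+x≡y → ≡.trans (≡.sym (cancel a x)) (cong (ℤ._- a) a+x≡y))
                           (λ x≡y-a → ≡.trans (cong (λ z → a ℤ.+ z) x≡y-a) (restore a y))
    where
    cancel : ∀ a x → (a ℤ.+ x) ℤ.- a ≡ x
    cancel = ℤ-Solver.solve-∀
    restore : ∀ a y → a ℤ.+ (y ℤ.- a) ≡ y
    restore = ℤ-Solver.solve-∀

  -- P k x = (-1)^(k-1) binom(x-1, k-1) for k ≥ 1 and P 0 x = 0, computed from the
  -- recurrence P (k+1) (x+1) = P (k+1) x - P k x, P (k+1) 0 = 1 (run backwards for x < 0).
  P⁺ : ℕ → ℕ → Carrier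
  P⁺ zero n = 0#
  P⁺ (suc k) zero = 1#
  P⁺ (suc k) (suc n) = P⁺ (suc k) n - P⁺ k n

  P⁻ : ℕ → ℕ → Carrier
  P⁻ zero n = 0#
  P⁻ (suc k) zero = 1# + P⁻ k zero
  P⁻ (suc k) (suc n) = P⁻ (suc k) n + P⁻ k (suc n)

  P : ℕ → ℤ → Carrier
  P k (+ n) = P⁺ k n
  P k -[1+ n ] = P⁻ k n

  P-zero : ∀ x → P 0 x ≈ 0#
  P-zero (+ n) = ≈-refl
  P-zero -[1+ n ] = ≈-refl

  P-suc : ∀ k x → P (suc k) (ℤ.suc x) ≈ P (suc k) x - P k x
  P-suc k (+ n) = ≈-refl
  P-suc k -[1+ zero ] = ≈-sym (x+y-y≈x 1# (P⁻ k zero))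
  P-suc k -[1+ suc n ] = ≈-sym (x+y-y≈x _ _)

  P-difference : ∀ k x → P (suc k) x - P (suc k) (ℤ.suc x) ≈ P k x
  P-difference k x = ≈-trans (+-congˡ (-‿cong (P-suc k x))) (x-[x-y]≈y _ _)

  P-root : ∀ k n → n ℕ.< k → P (suc k) (+ suc n) ≈ 0#
  P-root (suc k) zero _ = x-x≈0 1#
  P-root (suc k) (suc n) (s≤s n<k) = begin
    P⁺ (suc (suc k)) (suc n) - P⁺ (suc k) (suc n)
      ≈⟨ +-cong (P-root (suc k) n (ℕP.m<n⇒m<1+n n<k)) (-‿cong (P-root k n n<k)) ⟩
    0# - 0# ≈⟨ x-x≈0 0# ⟩
    0# ∎

  sign : ℕ → Carrier
  sign zero = 1#
  sign (suc k) = - sign k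

  sign-involutive : ∀ k → sign k * sign k ≈ 1#
  sign-involutive zero = *-identityˡ 1#
  sign-involutive (suc k) = ≈-trans (-x*-y≈x*y (sign k) (sign k)) (sign-involutive k)

  sign*P-top : ∀ k → sign (suc k) * P (suc k) (+ suc k) ≈ - 1#
  sign*P-top zero = ≈-trans (*-congˡ (≈-trans (+-congˡ -0#≈0#) (+-identityʳ 1#))) (*-identityʳ (- 1#))
  sign*P-top (suc k) = begin
    (- sign (suc k)) * (P⁺ (suc (suc k)) (suc k) - P⁺ (suc k) (suc k))
      ≈⟨ *-congˡ (+-congʳ (P-root (suc k) k (ℕP.n<1+n k))) ⟩
    (- sign (suc k)) * (0# - P⁺ (suc k) (suc k)) ≈⟨ *-congˡ (+-identityˡ _) ⟩
    (- sign (suc k)) * (- P⁺ (suc k) (suc k)) ≈⟨ -x*-y≈x*y _ _ ⟩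
    sign (suc k) * P (suc k) (+ suc k) ≈⟨ sign*P-top k ⟩
    - 1# ∎

  agree-by-differences : (F G H : ℤ → Carrier) →
    (∀ x → F (ℤ.suc x) ≈ F x + H x) → (∀ x → G (ℤ.suc x) ≈ G x + H x) →
    F (+ 0) ≈ G (+ 0) → ∀ x → F x ≈ G x
  agree-by-differences F G H ΔF ΔG F0≈G0 = agree
    where
    backwards : ∀ {a b h} → a ≈ b + h → b ≈ a - h
    backwards {a} {b} {h} a≈b+h = ≈-trans (≈-sym (x+y-y≈x b h)) (+-congʳ (≈-sym a≈b+h))
    agree⁺ : ∀ n → F (+ n) ≈ G (+ n)
    agree⁺ zero = F0≈G0
    agree⁺ (suc n) = ≈-trans (ΔF (+ n)) (≈-trans (+-congʳ (agree⁺ n)) (≈-sym (ΔG (+ n))))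
    agree⁻ : ∀ n → F -[1+ n ] ≈ G -[1+ n ]
    agree⁻ zero = ≈-trans (backwards (ΔF -[1+ 0 ]))
      (≈-trans (+-congʳ F0≈G0) (≈-sym (backwards (ΔG -[1+ 0 ]))))
    agree⁻ (suc n) = ≈-trans (backwards (ΔF -[1+ suc n ]))
      (≈-trans (+-congʳ (agree⁻ n)) (≈-sym (backwards (ΔG -[1+ suc n ]))))
    agree : ∀ x → F x ≈ G x
    agree (+ n) = agree⁺ n
    agree -[1+ n ] = agree⁻ n

  P-reflection : ∀ k b → sign k * P k (b ℤ.+ + k) ≈ - P k (ℤ.- b)
  P-reflection zero b = begin
    1# * P 0 (b ℤ.+ + 0) ≈⟨ *-congˡ (P-zero (b ℤ.+ + 0)) ⟩
    1# * 0# ≈⟨ zeroʳ 1# ⟩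
    0# ≈⟨ ≈-sym -0#≈0# ⟩
    - 0# ≈⟨ -‿cong (≈-sym (P-zero (ℤ.- b))) ⟩
    - P 0 (ℤ.- b) ∎
  P-reflection (suc k) = agree-by-differences F G H ΔF ΔG (sign*P-top k)
    where
    F G H : ℤ → Carrier
    F b = sign (suc k) * P (suc k) (b ℤ.+ + suc k)
    G b = - P (suc k) (ℤ.- b)
    H b = - P k (ℤ.- ℤ.suc b)
    suc-outside : ∀ b j → (+ 1 ℤ.+ b) ℤ.+ j ≡ + 1 ℤ.+ (b ℤ.+ j)
    suc-outside = ℤ-Solver.solve-∀
    suc-inside : ∀ b → ℤ.suc b ℤ.+ + k ≡ b ℤ.+ + suc k
    suc-inside b = ≡.trans (shuffle b (+ k)) (cong (λ z → b ℤ.+ z) (≡.sym (ℤP.pos-+ 1 k)))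
      where
      shuffle : ∀ b j → (+ 1 ℤ.+ b) ℤ.+ j ≡ b ℤ.+ (+ 1 ℤ.+ j)
      shuffle = ℤ-Solver.solve-∀
    neg-suc : ∀ b → ℤ.- b ≡ + 1 ℤ.+ ℤ.- (+ 1 ℤ.+ b)
    neg-suc = ℤ-Solver.solve-∀
    ΔF : ∀ b → F (ℤ.suc b) ≈ F b + H b
    ΔF b = begin
      sign (suc k) * P (suc k) (ℤ.suc b ℤ.+ + suc k)
        ≈⟨ *-congˡ (≈-reflexive (cong (P (suc k)) (suc-outside b (+ suc k)))) ⟩
      sign (suc k) * P (suc k) (ℤ.suc y) ≈⟨ *-congˡ (P-suc k y) ⟩
      sign (suc k) * (P (suc k) y - P k y) ≈⟨ x[y-z]≈xy-xz _ _ _ ⟩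
      F b - sign (suc k) * P k y ≈⟨ +-congˡ (-‿cong reflected) ⟩
      F b + H b ∎
      where
      y = b ℤ.+ + suc k
      reflected : sign (suc k) * P k y ≈ P k (ℤ.- ℤ.suc b)
      reflected = begin
        (- sign k) * P k y ≈⟨ ≈-sym (-‿distribˡ-* _ _) ⟩
        - (sign k * P k y) ≈⟨ -‿cong (*-congˡ (≈-reflexive (cong (P k) (≡.sym (suc-inside b))))) ⟩
        - (sign k * P k (ℤ.suc b ℤ.+ + k)) ≈⟨ -‿cong (P-reflection k (ℤ.suc b)) ⟩
        - - P k (ℤ.- ℤ.suc b) ≈⟨ -‿involutive _ ⟩
        P k (ℤ.- ℤ.suc b) ∎
    ΔG : ∀ b → G (ℤ.suc b) ≈ G b + H b
    ΔG b = begin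
      - P (suc k) y ≈⟨ -‿cong (≈-sym (x-y+y≈x _ _)) ⟩
      - ((P (suc k) y - P k y) + P k y)
        ≈⟨ -‿cong (+-congʳ (≈-sym (≈-trans (≈-reflexive (cong (P (suc k)) (neg-suc b))) (P-suc k y)))) ⟩
      - (P (suc k) (ℤ.- b) + P k y) ≈⟨ ≈-sym (-‿+-comm _ _) ⟩
      G b + H b ∎
      where y = ℤ.- ℤ.suc b

  -- Pairing of Laurent polynomials with weights on exponent pairs

  Weight : Set c
  Weight = ℤ → ℤ → Carrier

  infix 4 _≐_
  _≐_ : Weight → Weight → Set ℓ
  w ≐ w′ = ∀ a b → w a b ≈ w′ a b

  ⟪_,_⟫ : LP → Weight → Carrier
  ⟪ [] , w ⟫ = 0#
  ⟪ (r , a , b) ∷ p , w ⟫ = r * w a b + ⟪ p , w ⟫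

  pair-cong : ∀ p {w w′} → w ≐ w′ → ⟪ p , w ⟫ ≈ ⟪ p , w′ ⟫
  pair-cong [] w≐w′ = ≈-refl
  pair-cong ((r , a , b) ∷ p) w≐w′ = +-cong (*-congˡ (w≐w′ a b)) (pair-cong p w≐w′)

  pair-++ : ∀ p q w → ⟪ p ++ q , w ⟫ ≈ ⟪ p , w ⟫ + ⟪ q , w ⟫
  pair-++ [] q w = ≈-sym (+-identityˡ _)
  pair-++ ((r , a , b) ∷ p) q w = ≈-trans (+-congˡ (pair-++ p q w)) (≈-sym (+-assoc _ _ _))

  pair-zero : ∀ p → ⟪ p , (λ _ _ → 0#) ⟫ ≈ 0#
  pair-zero [] = ≈-refl
  pair-zero ((r , a , b) ∷ p) = ≈-trans (+-cong (zeroʳ r) (pair-zero p)) 0+0≈0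

  pair-scale : ∀ p κ w → ⟪ p , (λ a b → κ * w a b) ⟫ ≈ κ * ⟪ p , w ⟫
  pair-scale [] κ w = ≈-sym (zeroʳ κ)
  pair-scale ((r , a , b) ∷ p) κ w =
    ≈-trans (+-cong (x*[y*z]≈y*[x*z] r κ _) (pair-scale p κ w)) (≈-sym (distribˡ κ _ _))

  pair-neg : ∀ p w → ⟪ p , (λ a b → - w a b) ⟫ ≈ - ⟪ p , w ⟫
  pair-neg [] w = ≈-sym -0#≈0#
  pair-neg ((r , a , b) ∷ p) w =
    ≈-trans (+-cong (≈-sym (-‿distribʳ-* r _)) (pair-neg p w)) (-‿+-comm _ _)

  pair-sub : ∀ p w w′ → ⟪ p , (λ a b → w a b - w′ a b) ⟫ ≈ ⟪ p , w ⟫ - ⟪ p , w′ ⟫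
  pair-sub [] w w′ = ≈-sym (x-x≈0 0#)
  pair-sub ((r , a , b) ∷ p) w w′ = begin
    r * (w a b - w′ a b) + ⟪ p , (λ a b → w a b - w′ a b) ⟫
      ≈⟨ +-cong (x[y-z]≈xy-xz r _ _) (pair-sub p w w′) ⟩
    (r * w a b - r * w′ a b) + (⟪ p , w ⟫ - ⟪ p , w′ ⟫)
      ≈⟨ ≈-sym ([x+y]-[z+w]≈[x-z]+[y-w] _ _ _ _) ⟩
    (r * w a b + ⟪ p , w ⟫) - (r * w′ a b + ⟪ p , w′ ⟫) ∎

  translate : ℤ → ℤ → Weight → Weight
  translate a b w a′ b′ = w (a ℤ.+ a′) (b ℤ.+ b′)

  translate-0 : ∀ w → translate (+ 0) (+ 0) w ≐ w
  translate-0 w a b = ≈-reflexive (cong₂ w (ℤP.+-identityˡ a) (ℤP.+-identityˡ b))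

  pair-monomial-⊗ : ∀ r a b q w → ⟪ ((r , a , b) ∷ []) ⊗ q , w ⟫ ≈ r * ⟪ q , translate a b w ⟫
  pair-monomial-⊗ r a b [] w = ≈-sym (zeroʳ r)
  pair-monomial-⊗ r a b ((s , a′ , b′) ∷ q) w =
    ≈-trans (+-cong (*-assoc r s _) (pair-monomial-⊗ r a b q w)) (≈-sym (distribˡ r _ _))

  pair-⊗ : ∀ p q w → ⟪ p ⊗ q , w ⟫ ≈ ⟪ p , (λ a b → ⟪ q , translate a b w ⟫) ⟫
  pair-⊗ [] q w = ≈-refl
  pair-⊗ ((r , a , b) ∷ p) q w = begin
    ⟪ map scaled q ++ (p ⊗ q) , w ⟫
      ≈⟨ pair-++ (map scaled q) (p ⊗ q) w ⟩
    ⟪ map scaled q , w ⟫ + ⟪ p ⊗ q , w ⟫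
      ≈⟨ +-cong (≈-trans (≈-sym (+-identityʳ _)) (≈-sym (pair-++ (map scaled q) [] w))) (pair-⊗ p q w) ⟩
    ⟪ ((r , a , b) ∷ []) ⊗ q , w ⟫ + ⟪ p , (λ a b → ⟪ q , translate a b w ⟫) ⟫
      ≈⟨ +-congʳ (pair-monomial-⊗ r a b q w) ⟩
    ⟪ (r , a , b) ∷ p , (λ a b → ⟪ q , translate a b w ⟫) ⟫ ∎
    where
    scaled : Term → Term
    scaled (s , a′ , b′) = (r * s , a ℤ.+ a′ , b ℤ.+ b′)

  pair-⊗-one : ∀ p w → ⟪ p ⊗ one , w ⟫ ≈ ⟪ p , w ⟫
  pair-⊗-one p w = ≈-trans (pair-⊗ p one w) (pair-cong p unit)
    where
    unit : (λ a b → ⟪ one , translate a b w ⟫) ≐ w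
    unit a b = ≈-trans (+-identityʳ _) (≈-trans (*-identityˡ _)
      (≈-reflexive (cong₂ w (ℤP.+-identityʳ a) (ℤP.+-identityʳ b))))

  -- exponents of x_i and x_j in the monomial x_v / x_w of the factor  oneMinus v
  dirᵢ dirⱼ : Var → ℤ
  dirᵢ vi = + 1
  dirᵢ vj = -[1+ 0 ]
  dirⱼ vi = -[1+ 0 ]
  dirⱼ vj = + 1

  oneMinus-shape : ∀ v → oneMinus v ≡ (1# , + 0 , + 0) ∷ (- 1# , dirᵢ v , dirⱼ v) ∷ []
  oneMinus-shape vi = refl
  oneMinus-shape vj = refl

  -- Multiplication by oneMinus v acts on coefficient functions as Δ v, and, dually,
  -- on the weights it is paired with as ∇ v.
  ∇ : Var → Weight → Weight
  ∇ v w a b = w a b - translate (dirᵢ v) (dirⱼ v) w a b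

  Δ : Var → Weight → Weight
  Δ v g e f = g e f - g (e ℤ.- dirᵢ v) (f ℤ.- dirⱼ v)

  pair-oneMinus-⊗ : ∀ v V w → ⟪ oneMinus v ⊗ V , w ⟫ ≈ ⟪ V , ∇ v w ⟫
  pair-oneMinus-⊗ v V w rewrite oneMinus-shape v = begin
    ⟪ ((1# , + 0 , + 0) ∷ (- 1# , dirᵢ v , dirⱼ v) ∷ []) ⊗ V , w ⟫
      ≈⟨ pair-⊗ ((1# , + 0 , + 0) ∷ (- 1# , dirᵢ v , dirⱼ v) ∷ []) V w ⟩
    1# * ⟪ V , translate (+ 0) (+ 0) w ⟫ + ((- 1#) * ⟪ V , translate (dirᵢ v) (dirⱼ v) w ⟫ + 0#)
      ≈⟨ +-cong (≈-trans (*-identityˡ _) (pair-cong V (translate-0 w)))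
                (≈-trans (+-identityʳ _) (-1*x≈-x _)) ⟩
    ⟪ V , w ⟫ - ⟪ V , translate (dirᵢ v) (dirⱼ v) w ⟫ ≈⟨ ≈-sym (pair-sub V w _) ⟩
    ⟪ V , ∇ v w ⟫ ∎

  translate-∇ : ∀ v a b w → translate a b (∇ v w) ≐ ∇ v (translate a b w)
  translate-∇ v a b w a′ b′ =
    +-congˡ (-‿cong (≈-reflexive (cong₂ w (shuffle (dirᵢ v) a a′) (shuffle (dirⱼ v) b b′))))
    where
    shuffle : ∀ d x y → d ℤ.+ (x ℤ.+ y) ≡ x ℤ.+ (d ℤ.+ y)
    shuffle = ℤ-Solver.solve-∀

  pair-⊗-oneMinus : ∀ v p V w → ⟪ p ⊗ (oneMinus v ⊗ V) , w ⟫ ≈ ⟪ p ⊗ V , ∇ v w ⟫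
  pair-⊗-oneMinus v p V w = begin
    ⟪ p ⊗ (oneMinus v ⊗ V) , w ⟫ ≈⟨ pair-⊗ p _ w ⟩
    ⟪ p , (λ a b → ⟪ oneMinus v ⊗ V , translate a b w ⟫) ⟫
      ≈⟨ pair-cong p (λ a b → ≈-trans (pair-oneMinus-⊗ v V _)
                                      (pair-cong V (λ a′ b′ → ≈-sym (translate-∇ v a b w a′ b′)))) ⟩
    ⟪ p , (λ a b → ⟪ V , translate a b (∇ v w) ⟫) ⟫ ≈⟨ ≈-sym (pair-⊗ p V _) ⟩
    ⟪ p ⊗ V , ∇ v w ⟫ ∎

  δ : ℤ → ℤ → Weight
  δ e f a b = if (a == e) ∧ (b == f) then 1# else 0#

  coeff-as-pair : ∀ p e f → coeff p e f ≈ ⟪ p , δ e f ⟫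
  coeff-as-pair [] e f = ≈-refl
  coeff-as-pair ((r , a , b) ∷ p) e f = +-cong (if-as-scale ((a == e) ∧ (b == f))) (coeff-as-pair p e f)
    where
    if-as-scale : ∀ B → (if B then r else 0#) ≈ r * (if B then 1# else 0#)
    if-as-scale true = ≈-sym (*-identityʳ r)
    if-as-scale false = ≈-sym (zeroʳ r)

  translate-δ : ∀ a b e f → translate a b (δ e f) ≐ δ (e ℤ.- a) (f ℤ.- b)
  translate-δ a b e f a′ b′ =
    ≈-reflexive (cong₂ (λ x y → if x ∧ y then 1# else 0#) (==-shift a a′ e) (==-shift b b′ f))

  coeff-++ : ∀ p q e f → coeff (p ++ q) e f ≈ coeff p e f + coeff q e f
  coeff-++ [] q e f = ≈-sym (+-identityˡ _)
  coeff-++ ((r , a , b) ∷ p) q e f = ≈-trans (+-congˡ (coeff-++ p q e f)) (≈-sym (+-assoc _ _ _))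

  coeff-monomial-⊗ : ∀ r a b q e f → coeff (((r , a , b) ∷ []) ⊗ q) e f ≈ r * coeff q (e ℤ.- a) (f ℤ.- b)
  coeff-monomial-⊗ r a b q e f = begin
    coeff (((r , a , b) ∷ []) ⊗ q) e f ≈⟨ coeff-as-pair (((r , a , b) ∷ []) ⊗ q) e f ⟩
    ⟪ ((r , a , b) ∷ []) ⊗ q , δ e f ⟫ ≈⟨ pair-monomial-⊗ r a b q _ ⟩
    r * ⟪ q , translate a b (δ e f) ⟫ ≈⟨ *-congˡ (pair-cong q (translate-δ a b e f)) ⟩
    r * ⟪ q , δ (e ℤ.- a) (f ℤ.- b) ⟫ ≈⟨ *-congˡ (≈-sym (coeff-as-pair q _ _)) ⟩
    r * coeff q (e ℤ.- a) (f ℤ.- b) ∎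

  coeff-via-∇ : ∀ v X Y → (∀ w → ⟪ X , w ⟫ ≈ ⟪ Y , ∇ v w ⟫) → coeff X ≐ Δ v (coeff Y)
  coeff-via-∇ v X Y X~Y e f = begin
    coeff X e f ≈⟨ coeff-as-pair X e f ⟩
    ⟪ X , δ e f ⟫ ≈⟨ X~Y (δ e f) ⟩
    ⟪ Y , ∇ v (δ e f) ⟫ ≈⟨ pair-sub Y _ _ ⟩
    ⟪ Y , δ e f ⟫ - ⟪ Y , translate (dirᵢ v) (dirⱼ v) (δ e f) ⟫
      ≈⟨ +-cong (≈-sym (coeff-as-pair Y e f))
                (-‿cong (≈-trans (pair-cong Y (translate-δ _ _ e f)) (≈-sym (coeff-as-pair Y _ _)))) ⟩
    Δ v (coeff Y) e f ∎

  coeff-oneMinus-⊗ : ∀ v V → coeff (oneMinus v ⊗ V) ≐ Δ v (coeff V)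
  coeff-oneMinus-⊗ v V = coeff-via-∇ v (oneMinus v ⊗ V) V (pair-oneMinus-⊗ v V)

  Δ-cong : ∀ v {g h} → g ≐ h → Δ v g ≐ Δ v h
  Δ-cong v g≐h e f = +-cong (g≐h e f) (-‿cong (g≐h _ _))

  Δ^ : Var → ℕ → Weight → Weight
  Δ^ v zero g = g
  Δ^ v (suc k) g = Δ v (Δ^ v k g)

  Δ^-cong : ∀ v k {g h} → g ≐ h → Δ^ v k g ≐ Δ^ v k h
  Δ^-cong v zero g≐h = g≐h
  Δ^-cong v (suc k) g≐h = Δ-cong v (Δ^-cong v k g≐h)

  coeff-⊗-oneMinus^ : ∀ v k p → coeff (p ⊗ (oneMinus v ^^ k)) ≐ Δ^ v k (coeff p)
  coeff-⊗-oneMinus^ v zero p e f = begin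
    coeff (p ⊗ one) e f ≈⟨ coeff-as-pair (p ⊗ one) e f ⟩
    ⟪ p ⊗ one , δ e f ⟫ ≈⟨ pair-⊗-one p _ ⟩
    ⟪ p , δ e f ⟫ ≈⟨ ≈-sym (coeff-as-pair p e f) ⟩
    coeff p e f ∎
  coeff-⊗-oneMinus^ v (suc k) p e f =
    ≈-trans (coeff-via-∇ v (p ⊗ (oneMinus v ^^ suc k)) (p ⊗ (oneMinus v ^^ k)) (pair-⊗-oneMinus v p _) e f)
            (Δ-cong v (coeff-⊗-oneMinus^ v k p) e f)

  monomial : Carrier → ℤ → ℤ → Weight
  monomial r a b e f = if (a == e) ∧ (b == f) then r else 0#

  monomial-at : ∀ r a b → monomial r a b a b ≈ r
  monomial-at r a b rewrite ==-refl a | ==-refl b = ≈-refl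

  monomial-off : ∀ r a b e f → (e , f) ≢ (a , b) → monomial r a b e f ≈ 0#
  monomial-off r a b e f ef≢ab with a ℤ.≟ e | b ℤ.≟ f
  ... | yes refl | yes refl = ⊥-elim (ef≢ab refl)
  ... | yes _ | no _ = ≈-refl
  ... | no _ | _ = ≈-refl

  windowSum : ℕ → (ℤ → Carrier) → Carrier
  windowSum zero h = h (+ 0)
  windowSum (suc B) h = (h (+ suc B) + h -[1+ B ]) + windowSum B h

  windowSum-cong : ∀ B {g h} → (∀ e → g e ≈ h e) → windowSum B g ≈ windowSum B h
  windowSum-cong zero g≈h = g≈h (+ 0)
  windowSum-cong (suc B) g≈h = +-cong (+-cong (g≈h _) (g≈h _)) (windowSum-cong B g≈h)

  windowSum-+ : ∀ B g h → windowSum B (λ e → g e + h e) ≈ windowSum B g + windowSum B h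
  windowSum-+ zero g h = ≈-refl
  windowSum-+ (suc B) g h = ≈-trans (+-cong ([x+y]+[z+w]≈[x+z]+[y+w] _ _ _ _) (windowSum-+ B g h))
                              ([x+y]+[z+w]≈[x+z]+[y+w] _ _ _ _)

  windowSum-vanishing : ∀ B h → (∀ e → ∣ e ∣ ℕ.≤ B → h e ≈ 0#) → windowSum B h ≈ 0#
  windowSum-vanishing zero h h≈0 = h≈0 (+ 0) z≤n
  windowSum-vanishing (suc B) h h≈0 = begin
    (h (+ suc B) + h -[1+ B ]) + windowSum B h
      ≈⟨ +-cong (+-cong (h≈0 _ ℕP.≤-refl) (h≈0 _ ℕP.≤-refl))
                (windowSum-vanishing B h (λ e ∣e∣≤B → h≈0 e (ℕP.m≤n⇒m≤1+n ∣e∣≤B))) ⟩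
    (0# + 0#) + 0# ≈⟨ ≈-trans (+-congʳ 0+0≈0) 0+0≈0 ⟩
    0# ∎

  shorter-≢ : ∀ {B e x} → ∣ x ∣ ≡ suc B → ∣ e ∣ ℕ.≤ B → e ≢ x
  shorter-≢ ∣x∣≡1+B ∣e∣≤B refl = ℕP.1+n≰n (≡.subst (ℕ._≤ _) ∣x∣≡1+B ∣e∣≤B)

  windowSum-edge : ∀ B h x → ∣ x ∣ ≡ suc B → (∀ e → e ≢ x → h e ≈ 0#) → windowSum (suc B) h ≈ h x
  windowSum-edge B h (+ _) refl h≈0 = begin
    (h (+ suc B) + h -[1+ B ]) + windowSum B h
      ≈⟨ +-cong (+-congˡ (h≈0 _ (λ ()))) (windowSum-vanishing B h (λ e ∣e∣≤B → h≈0 e (shorter-≢ refl ∣e∣≤B))) ⟩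
    (h (+ suc B) + 0#) + 0# ≈⟨ ≈-trans (+-identityʳ _) (+-identityʳ _) ⟩
    h (+ suc B) ∎
  windowSum-edge B h -[1+ _ ] refl h≈0 = begin
    (h (+ suc B) + h -[1+ B ]) + windowSum B h
      ≈⟨ +-cong (+-congʳ (h≈0 _ (λ ()))) (windowSum-vanishing B h (λ e ∣e∣≤B → h≈0 e (shorter-≢ refl ∣e∣≤B))) ⟩
    (0# + h -[1+ B ]) + 0# ≈⟨ ≈-trans (+-identityʳ _) (+-identityˡ _) ⟩
    h -[1+ B ] ∎

  windowSum-point : ∀ B h x → ∣ x ∣ ℕ.≤ B → (∀ e → e ≢ x → h e ≈ 0#) → windowSum B h ≈ h x
  windowSum-point zero h (+ zero) _ _ = ≈-refl
  windowSum-point (suc B) h x ∣x∣≤1+B h≈0 with ℕP.m≤n⇒m<n∨m≡n ∣x∣≤1+B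
  ... | inj₂ ∣x∣≡1+B = windowSum-edge B h x ∣x∣≡1+B h≈0
  ... | inj₁ (s≤s ∣x∣≤B) = begin
    (h (+ suc B) + h -[1+ B ]) + windowSum B h
      ≈⟨ +-cong (+-cong (h≈0 _ (outside refl)) (h≈0 _ (outside refl))) (windowSum-point B h x ∣x∣≤B h≈0) ⟩
    (0# + 0#) + h x ≈⟨ ≈-trans (+-congʳ 0+0≈0) (+-identityˡ _) ⟩
    h x ∎
    where
    outside : ∀ {e} → ∣ e ∣ ≡ suc B → e ≢ x
    outside ∣e∣≡1+B e≡x = shorter-≢ ∣e∣≡1+B ∣x∣≤B (≡.sym e≡x)

  boxSum : ℕ → Weight → Carrier
  boxSum B h = windowSum B (λ e → windowSum B (h e))

  boxSum-cong : ∀ B {g h} → g ≐ h → boxSum B g ≈ boxSum B h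
  boxSum-cong B g≐h = windowSum-cong B (λ e → windowSum-cong B (g≐h e))

  boxSum-+ : ∀ B g h → boxSum B (λ e f → g e f + h e f) ≈ boxSum B g + boxSum B h
  boxSum-+ B g h = ≈-trans (windowSum-cong B (λ e → windowSum-+ B (g e) (h e))) (windowSum-+ B _ _)

  boxSum-zero : ∀ B h → (∀ e f → h e f ≈ 0#) → boxSum B h ≈ 0#
  boxSum-zero B h h≈0 = windowSum-vanishing B _ (λ e _ → windowSum-vanishing B (h e) (λ f _ → h≈0 e f))

  boxSum-point : ∀ B h x y → ∣ x ∣ ℕ.≤ B → ∣ y ∣ ℕ.≤ B →
               (∀ e f → (e , f) ≢ (x , y) → h e f ≈ 0#) → boxSum B h ≈ h x y
  boxSum-point B h x y ∣x∣≤B ∣y∣≤B h≈0 = begin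
    windowSum B (λ e → windowSum B (h e))
      ≈⟨ windowSum-point B _ x ∣x∣≤B (λ e e≢x → row-zero e (λ f → h≈0 e f (λ ef≡xy → e≢x (cong proj₁ ef≡xy)))) ⟩
    windowSum B (h x)
      ≈⟨ windowSum-point B (h x) y ∣y∣≤B (λ f f≢y → h≈0 x f (λ xf≡xy → f≢y (cong proj₂ xf≡xy))) ⟩
    h x y ∎
    where
    row-zero : ∀ e → (∀ f → h e f ≈ 0#) → windowSum B (h e) ≈ 0#
    row-zero e row≈0 = windowSum-vanishing B (h e) (λ f _ → row≈0 f)

  bound : LP → ℕ
  bound [] = 0
  bound ((r , a , b) ∷ p) = (∣ a ∣ ℕ.+ ∣ b ∣) ℕ.+ bound p

  pair-as-boxSum : ∀ p w B → bound p ℕ.≤ B → ⟪ p , w ⟫ ≈ boxSum B (λ e f → coeff p e f * w e f)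
  pair-as-boxSum [] w B _ = ≈-sym (boxSum-zero B _ (λ e f → zeroˡ _))
  pair-as-boxSum ((r , a , b) ∷ p) w B bound≤B = ≈-sym (begin
    boxSum B (λ e f → (monomial r a b e f + coeff p e f) * w e f)
      ≈⟨ boxSum-cong B (λ e f → distribʳ _ _ _) ⟩
    boxSum B (λ e f → monomial r a b e f * w e f + coeff p e f * w e f) ≈⟨ boxSum-+ B _ _ ⟩
    boxSum B (λ e f → monomial r a b e f * w e f) + boxSum B (λ e f → coeff p e f * w e f)
      ≈⟨ +-cong (boxSum-point B _ a b ∣a∣≤B ∣b∣≤B
                  (λ e f ef≢ab → ≈-trans (*-congʳ (monomial-off r a b e f ef≢ab)) (zeroˡ _)))
                (≈-sym (pair-as-boxSum p w B (ℕP.≤-trans (ℕP.m≤n+m (bound p) _) bound≤B))) ⟩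
    monomial r a b a b * w a b + ⟪ p , w ⟫ ≈⟨ +-congʳ (*-congʳ (monomial-at r a b)) ⟩
    r * w a b + ⟪ p , w ⟫ ∎)
    where
    ∣a∣+∣b∣≤B = ℕP.≤-trans (ℕP.m≤m+n (∣ a ∣ ℕ.+ ∣ b ∣) (bound p)) bound≤B
    ∣a∣≤B = ℕP.≤-trans (ℕP.m≤m+n ∣ a ∣ ∣ b ∣) ∣a∣+∣b∣≤B
    ∣b∣≤B = ℕP.≤-trans (ℕP.m≤n+m ∣ b ∣ ∣ a ∣) ∣a∣+∣b∣≤B

  pair-resp-≋ : ∀ p q w → p ≋ q → ⟪ p , w ⟫ ≈ ⟪ q , w ⟫
  pair-resp-≋ p q w p≋q = begin
    ⟪ p , w ⟫ ≈⟨ pair-as-boxSum p w B (ℕP.m≤m+n (bound p) (bound q)) ⟩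
    boxSum B (λ e f → coeff p e f * w e f) ≈⟨ boxSum-cong B (λ e f → *-congʳ (p≋q e f)) ⟩
    boxSum B (λ e f → coeff q e f * w e f) ≈⟨ ≈-sym (pair-as-boxSum q w B (ℕP.m≤n+m (bound q) (bound p))) ⟩
    ⟪ q , w ⟫ ∎
    where B = bound p ℕ.+ bound q

  pair-vanishing : ∀ p w → (∀ e f → coeff p e f * w e f ≈ 0#) → ⟪ p , w ⟫ ≈ 0#
  pair-vanishing p w terms≈0 =
    ≈-trans (pair-as-boxSum p w (bound p) ℕP.≤-refl) (boxSum-zero (bound p) _ terms≈0)

  pair-point : ∀ p w x y → (∀ e f → (e , f) ≢ (x , y) → coeff p e f * w e f ≈ 0#) →
               ⟪ p , w ⟫ ≈ coeff p x y * w x y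
  pair-point p w x y terms≈0 =
    ≈-trans (pair-as-boxSum p w B (ℕP.m≤m+n (bound p) _))
            (boxSum-point B _ x y (ℕP.≤-trans (ℕP.m≤m+n ∣ x ∣ ∣ y ∣) ∣x∣+∣y∣≤B)
                                (ℕP.≤-trans (ℕP.m≤n+m ∣ y ∣ ∣ x ∣) ∣x∣+∣y∣≤B) terms≈0)
    where
    B = bound p ℕ.+ (∣ x ∣ ℕ.+ ∣ y ∣)
    ∣x∣+∣y∣≤B = ℕP.m≤n+m (∣ x ∣ ℕ.+ ∣ y ∣) (bound p)

  -- Residue functionals.  ⟪ p , residueWeight v k 0 d ⟫ is the coefficient of x_w^d in the
  -- bracket [v,w] of p / (1 - x_v/x_w)^k, w the other variable: it annihilates
  -- (1 - x_v/x_w)^k L₁ and reads A(0) off every A of degree < k in x_v.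

  residueWeight : Var → ℕ → ℤ → ℤ → Weight
  residueWeight v k s d a b = if (a ℤ.+ b) == d then P k (expOf v a b ℤ.- s) else 0#

  ∇-degree : ∀ v a b → (dirᵢ v ℤ.+ a) ℤ.+ (dirⱼ v ℤ.+ b) ≡ a ℤ.+ b
  ∇-degree vi = ℤ-Solver.solve-∀
  ∇-degree vj = ℤ-Solver.solve-∀

  [1+x]-s≡1+[x-s] : ∀ x s → (+ 1 ℤ.+ x) ℤ.- s ≡ + 1 ℤ.+ (x ℤ.- s)
  [1+x]-s≡1+[x-s] = ℤ-Solver.solve-∀

  ∇-exponent : ∀ v a b s → expOf v (dirᵢ v ℤ.+ a) (dirⱼ v ℤ.+ b) ℤ.- s ≡ + 1 ℤ.+ (expOf v a b ℤ.- s)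
  ∇-exponent vi a b s = [1+x]-s≡1+[x-s] a s
  ∇-exponent vj a b s = [1+x]-s≡1+[x-s] b s

  ∇-residueWeight : ∀ v k s d → ∇ v (residueWeight v (suc k) s d) ≐ residueWeight v k s d
  ∇-residueWeight v k s d a b rewrite ∇-degree v a b | ∇-exponent v a b s with (a ℤ.+ b) == d
  ... | true = P-difference k (expOf v a b ℤ.- s)
  ... | false = x-x≈0 0#

  ∇ᵢ-residueWeightⱼ : ∀ k s d →
    ∇ vi (residueWeight vj (suc k) s d) ≐ λ a b → - residueWeight vj k (s ℤ.+ + 1) d a b
  ∇ᵢ-residueWeightⱼ k s d a b rewrite ∇-degree vi a b with (a ℤ.+ b) == d
  ... | true = begin
    P (suc k) (b ℤ.- s) - P (suc k) y ≈⟨ x-y≈-[y-x] _ _ ⟩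
    - (P (suc k) y - P (suc k) (b ℤ.- s))
      ≈⟨ -‿cong (≈-trans (+-congˡ (-‿cong (≈-reflexive (cong (P (suc k)) (unshift b s))))) (P-difference k y)) ⟩
    - P k y ≈⟨ -‿cong (≈-reflexive (cong (P k) (regroup b s))) ⟩
    - P k (b ℤ.- (s ℤ.+ + 1)) ∎
    where
    y = (-[1+ 0 ] ℤ.+ b) ℤ.- s
    unshift : ∀ b s → b ℤ.- s ≡ + 1 ℤ.+ ((-[1+ 0 ] ℤ.+ b) ℤ.- s)
    unshift = ℤ-Solver.solve-∀
    regroup : ∀ b s → (-[1+ 0 ] ℤ.+ b) ℤ.- s ≡ b ℤ.- (s ℤ.+ + 1)
    regroup = ℤ-Solver.solve-∀
  ... | false = ≈-trans (x-x≈0 0#) (≈-sym -0#≈0#)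

  residue-zero : ∀ v s d p → ⟪ p , residueWeight v 0 s d ⟫ ≈ 0#
  residue-zero v s d p = ≈-trans (pair-cong p weight≈0) (pair-zero p)
    where
    weight≈0 : residueWeight v 0 s d ≐ λ _ _ → 0#
    weight≈0 a b with (a ℤ.+ b) == d
    ... | true = P-zero (expOf v a b ℤ.- s)
    ... | false = ≈-refl

  residue-⊗-oneMinus^ : ∀ v j k s d p →
    ⟪ p ⊗ (oneMinus v ^^ j) , residueWeight v (j ℕ.+ k) s d ⟫ ≈ ⟪ p , residueWeight v k s d ⟫
  residue-⊗-oneMinus^ v zero k s d p = pair-⊗-one p _
  residue-⊗-oneMinus^ v (suc j) k s d p = begin
    ⟪ p ⊗ (oneMinus v ⊗ (oneMinus v ^^ j)) , residueWeight v (suc (j ℕ.+ k)) s d ⟫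
      ≈⟨ pair-⊗-oneMinus v p _ _ ⟩
    ⟪ p ⊗ (oneMinus v ^^ j) , ∇ v (residueWeight v (suc (j ℕ.+ k)) s d) ⟫
      ≈⟨ pair-cong (p ⊗ (oneMinus v ^^ j)) (∇-residueWeight v (j ℕ.+ k) s d) ⟩
    ⟪ p ⊗ (oneMinus v ^^ j) , residueWeight v (j ℕ.+ k) s d ⟫ ≈⟨ residue-⊗-oneMinus^ v j k s d p ⟩
    ⟪ p , residueWeight v k s d ⟫ ∎

  residueⱼ-⊗-oneMinusᵢ^ : ∀ j k s d p →
    ⟪ p ⊗ (oneMinus vi ^^ j) , residueWeight vj (j ℕ.+ k) s d ⟫ ≈
    sign j * ⟪ p , residueWeight vj k (s ℤ.+ + j) d ⟫
  residueⱼ-⊗-oneMinusᵢ^ zero k s d p = begin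
    ⟪ p ⊗ one , residueWeight vj k s d ⟫ ≈⟨ pair-⊗-one p _ ⟩
    ⟪ p , residueWeight vj k s d ⟫
      ≈⟨ ≈-reflexive (cong (λ t → ⟪ p , residueWeight vj k t d ⟫) (≡.sym (ℤP.+-identityʳ s))) ⟩
    ⟪ p , residueWeight vj k (s ℤ.+ + 0) d ⟫ ≈⟨ ≈-sym (*-identityˡ _) ⟩
    1# * ⟪ p , residueWeight vj k (s ℤ.+ + 0) d ⟫ ∎
  residueⱼ-⊗-oneMinusᵢ^ (suc j) k s d p = begin
    ⟪ p ⊗ (oneMinus vi ⊗ (oneMinus vi ^^ j)) , residueWeight vj (suc (j ℕ.+ k)) s d ⟫
      ≈⟨ pair-⊗-oneMinus vi p _ _ ⟩
    ⟪ p ⊗ (oneMinus vi ^^ j) , ∇ vi (residueWeight vj (suc (j ℕ.+ k)) s d) ⟫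
      ≈⟨ pair-cong (p ⊗ (oneMinus vi ^^ j)) (∇ᵢ-residueWeightⱼ (j ℕ.+ k) s d) ⟩
    ⟪ p ⊗ (oneMinus vi ^^ j) , (λ a b → - residueWeight vj (j ℕ.+ k) s′ d a b) ⟫
      ≈⟨ pair-neg (p ⊗ (oneMinus vi ^^ j)) _ ⟩
    - ⟪ p ⊗ (oneMinus vi ^^ j) , residueWeight vj (j ℕ.+ k) s′ d ⟫
      ≈⟨ -‿cong (residueⱼ-⊗-oneMinusᵢ^ j k s′ d p) ⟩
    - (sign j * ⟪ p , residueWeight vj k (s′ ℤ.+ + j) d ⟫) ≈⟨ -‿distribˡ-* _ _ ⟩
    sign (suc j) * ⟪ p , residueWeight vj k (s′ ℤ.+ + j) d ⟫
      ≈⟨ *-congˡ (≈-reflexive (cong (λ t → ⟪ p , residueWeight vj k t d ⟫) (regroup s j))) ⟩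
    sign (suc j) * ⟪ p , residueWeight vj k (s ℤ.+ + suc j) d ⟫ ∎
    where
    s′ = s ℤ.+ + 1
    regroup : ∀ s j → (s ℤ.+ + 1) ℤ.+ + j ≡ s ℤ.+ + suc j
    regroup s j = ≡.trans (ℤP.+-assoc s (+ 1) (+ j)) (cong (λ t → s ℤ.+ t) (≡.sym (ℤP.pos-+ 1 j)))

  InRange : ℤ → ℕ → Set
  InRange x q = (+ 0 ℤ.≤ x) × (x ℤ.< + q)

  P-or-coefficient-vanishes : ∀ q x {a : Carrier} → x ≢ + 0 → (¬ InRange x q → a ≈ 0#) → a * P q x ≈ 0#
  P-or-coefficient-vanishes q (+ zero) x≢0 _ = ⊥-elim (x≢0 refl)
  P-or-coefficient-vanishes zero (+ suc n) _ _ = zeroʳ _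
  P-or-coefficient-vanishes (suc q) (+ suc n) _ a≈0 with suc n ℕP.<? suc q
  ... | yes (s≤s n<q) = ≈-trans (*-congˡ (P-root q n n<q)) (zeroʳ _)
  ... | no n≮q = ≈-trans (*-congʳ (a≈0 λ { (_ , ℤ.+<+ n<q) → n≮q n<q })) (zeroˡ _)
  P-or-coefficient-vanishes q -[1+ n ] _ a≈0 = ≈-trans (*-congʳ (a≈0 λ { (() , _) })) (zeroˡ _)

  residue-polynomial-at : ∀ v q d A x y → IsPolyDegLt v A q → x ℤ.+ y ≡ d → expOf v x y ≡ + 0 →
    (∀ e f → e ℤ.+ f ≡ d → expOf v e f ≡ + 0 → (e , f) ≡ (x , y)) →
    ⟪ A , residueWeight v q (+ 0) d ⟫ ≈ coeff A x y
  residue-polynomial-at v q d A x y deg x+y≡d exponent≡0 unique = ≈-trans (pair-point A _ x y off) value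
    where
    off : ∀ e f → (e , f) ≢ (x , y) → coeff A e f * residueWeight v q (+ 0) d e f ≈ 0#
    off e f ef≢xy with (e ℤ.+ f) ℤ.≟ d
    ... | no _ = zeroʳ _
    ... | yes e+f≡d = P-or-coefficient-vanishes q _ exponent≢0 coefficient≈0
      where
      exponent≢0 : expOf v e f ℤ.- + 0 ≢ + 0
      exponent≢0 eq = ef≢xy (unique e f e+f≡d (≡.trans (≡.sym (ℤP.+-identityʳ _)) eq))
      coefficient≈0 : ¬ InRange (expOf v e f ℤ.- + 0) q → coeff A e f ≈ 0#
      coefficient≈0 out = deg e f (λ r → out (≡.subst (λ t → InRange t q) (≡.sym (ℤP.+-identityʳ _)) r))
    P-at-0 : ∀ q → IsPolyDegLt v A q → coeff A x y * P q (+ 0) ≈ coeff A x y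
    P-at-0 (suc q) _ = *-identityʳ _
    P-at-0 zero deg₀ =
      ≈-trans (zeroʳ _) (≈-sym (deg₀ x y λ { (0≤x , x<0) → ℤP.<-irrefl refl (ℤP.≤-<-trans 0≤x x<0) }))
    value : coeff A x y * residueWeight v q (+ 0) d x y ≈ coeff A x y
    value rewrite x+y≡d | ==-refl d | exponent≡0 = P-at-0 q deg

  residue-polynomial : ∀ v q d A → IsPolyDegLt v A q → ⟪ A , residueWeight v q (+ 0) d ⟫ ≈ ct v A d
  residue-polynomial vi q d A deg = residue-polynomial-at vi q d A (+ 0) d deg (ℤP.+-identityˡ d) refl
    λ { e f e+f≡d refl → cong (+ 0 ,_) (≡.trans (≡.sym (ℤP.+-identityˡ f)) e+f≡d) }
  residue-polynomial vj q d A deg = residue-polynomial-at vj q d A d (+ 0) deg (ℤP.+-identityʳ d) refl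
    λ { e f e+f≡d refl → cong (_, + 0) (≡.trans (≡.sym (ℤP.+-identityʳ e)) e+f≡d) }

  residue-homogeneous : ∀ v k s d L → IsHomogeneousDeg0 L → d ≢ + 0 → ⟪ L , residueWeight v k s d ⟫ ≈ 0#
  residue-homogeneous v k s d L hom d≢0 = pair-vanishing L _ term≈0
    where
    term≈0 : ∀ e f → coeff L e f * residueWeight v k s d e f ≈ 0#
    term≈0 e f with (e ℤ.+ f) ℤ.≟ d
    ... | yes refl = ≈-trans (*-congʳ (hom e f d≢0)) (zeroˡ _)
    ... | no _ = zeroʳ _

  residue-reflection : ∀ m p →
    sign m * ⟪ p , residueWeight vj m (ℤ.- (+ m)) (+ 0) ⟫ ≈ - ⟪ p , residueWeight vi m (+ 0) (+ 0) ⟫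
  residue-reflection m p = begin
    sign m * ⟪ p , residueWeight vj m (ℤ.- (+ m)) (+ 0) ⟫ ≈⟨ ≈-sym (pair-scale p (sign m) _) ⟩
    ⟪ p , (λ a b → sign m * residueWeight vj m (ℤ.- (+ m)) (+ 0) a b) ⟫ ≈⟨ pair-cong p reflected ⟩
    ⟪ p , (λ a b → - residueWeight vi m (+ 0) (+ 0) a b) ⟫ ≈⟨ pair-neg p _ ⟩
    - ⟪ p , residueWeight vi m (+ 0) (+ 0) ⟫ ∎
    where
    reflected : ∀ a b → sign m * residueWeight vj m (ℤ.- (+ m)) (+ 0) a b ≈ - residueWeight vi m (+ 0) (+ 0) a b
    reflected a b with (a ℤ.+ b) ℤ.≟ + 0
    ... | no _ = ≈-trans (zeroʳ _) (≈-sym -0#≈0#)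
    ... | yes a+b≡0 = begin
      sign m * P m (b ℤ.- ℤ.- (+ m))
        ≈⟨ *-congˡ (≈-reflexive (cong (λ t → P m (b ℤ.+ t)) (ℤP.neg-involutive (+ m)))) ⟩
      sign m * P m (b ℤ.+ + m) ≈⟨ P-reflection m b ⟩
      - P m (ℤ.- b) ≈⟨ -‿cong (≈-reflexive (cong (P m) -b≡a-0)) ⟩
      - P m (a ℤ.- + 0) ∎
      where
      -b≡a-0 : ℤ.- b ≡ a ℤ.- + 0
      -b≡a-0 = ≡.trans (≡.sym (ℤP.+-identityˡ (ℤ.- b)))
                 (≡.trans (cong (λ t → t ℤ.- b) (≡.sym a+b≡0))
                   (≡.trans (cancel a b) (≡.sym (ℤP.+-identityʳ a))))
        where
        cancel : ∀ a b → (a ℤ.+ b) ℤ.- b ≡ a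
        cancel = ℤ-Solver.solve-∀

  residue-partial-fraction : ∀ v q d L₁ A → IsPolyDegLt v A q →
    ⟪ (L₁ ⊗ (oneMinus v ^^ q)) ⊕ A , residueWeight v q (+ 0) d ⟫ ≈ ct v A d
  residue-partial-fraction v q d L₁ A deg = begin
    ⟪ (L₁ ⊗ (oneMinus v ^^ q)) ++ A , residueWeight v q (+ 0) d ⟫ ≈⟨ pair-++ (L₁ ⊗ (oneMinus v ^^ q)) A _ ⟩
    ⟪ L₁ ⊗ (oneMinus v ^^ q) , residueWeight v q (+ 0) d ⟫ + ⟪ A , residueWeight v q (+ 0) d ⟫
      ≈⟨ +-cong annihilated (residue-polynomial v q d A deg) ⟩
    0# + ct v A d ≈⟨ +-identityˡ _ ⟩
    ct v A d ∎
    where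
    annihilated : ⟪ L₁ ⊗ (oneMinus v ^^ q) , residueWeight v q (+ 0) d ⟫ ≈ 0#
    annihilated = begin
      ⟪ L₁ ⊗ (oneMinus v ^^ q) , residueWeight v q (+ 0) d ⟫
        ≈⟨ ≈-reflexive (cong (λ k → ⟪ L₁ ⊗ (oneMinus v ^^ q) , residueWeight v k (+ 0) d ⟫)
                             (≡.sym (ℕP.+-identityʳ q))) ⟩
      ⟪ L₁ ⊗ (oneMinus v ^^ q) , residueWeight v (q ℕ.+ 0) (+ 0) d ⟫ ≈⟨ residue-⊗-oneMinus^ v q 0 (+ 0) d L₁ ⟩
      ⟪ L₁ , residueWeight v 0 (+ 0) d ⟫ ≈⟨ residue-zero v (+ 0) d L₁ ⟩
      0# ∎

  bracketᵢ-unique : ∀ N m L₁ A q → IsPartialFraction vi N m L₁ A q →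
    ∀ d → ct vi A d ≈ ⟪ N , residueWeight vi m (+ 0) d ⟫
  bracketᵢ-unique N m L₁ A q (deg , N≋) d = ≈-sym (begin
    ⟪ N , W m ⟫ ≈⟨ ≈-sym (residue-⊗-oneMinus^ vi q m (+ 0) d N) ⟩
    ⟪ N ⊗ (oneMinus vi ^^ q) , W (q ℕ.+ m) ⟫
      ≈⟨ pair-resp-≋ (N ⊗ (oneMinus vi ^^ q)) (H ⊗ (oneMinus vi ^^ m)) (W (q ℕ.+ m)) N≋ ⟩
    ⟪ H ⊗ (oneMinus vi ^^ m) , W (q ℕ.+ m) ⟫
      ≈⟨ ≈-reflexive (cong (λ k → ⟪ H ⊗ (oneMinus vi ^^ m) , W k ⟫) (ℕP.+-comm q m)) ⟩
    ⟪ H ⊗ (oneMinus vi ^^ m) , W (m ℕ.+ q) ⟫ ≈⟨ residue-⊗-oneMinus^ vi m q (+ 0) d H ⟩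
    ⟪ H , W q ⟫ ≈⟨ residue-partial-fraction vi q d L₁ A deg ⟩
    ct vi A d ∎)
    where
    W : ℕ → Weight
    W k = residueWeight vi k (+ 0) d
    H = (L₁ ⊗ (oneMinus vi ^^ q)) ⊕ A

  -- For [j,i] the factor (1 - x_i/x_j)^m is traded for (1 - x_j/x_i)^m at the price of the
  -- sign (-1)^m and the shift of x_j-exponents by m.
  bracketⱼ-unique : ∀ N m L₁ A q → IsPartialFraction vj N m L₁ A q →
    ∀ d → ct vj A d ≈ sign m * ⟪ N , residueWeight vj m (ℤ.- (+ m)) d ⟫
  bracketⱼ-unique N m L₁ A q (deg , N≋) d = begin
    ct vj A d ≈⟨ ≈-sym (*-identityˡ _) ⟩
    1# * ct vj A d ≈⟨ *-congʳ (≈-sym (sign-involutive m)) ⟩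
    (sign m * sign m) * ct vj A d ≈⟨ *-assoc _ _ _ ⟩
    sign m * (sign m * ct vj A d) ≈⟨ *-congˡ (≈-sym residue-N) ⟩
    sign m * ⟪ N , W m s₀ ⟫ ∎
    where
    s₀ = ℤ.- (+ m)
    W : ℕ → ℤ → Weight
    W k s = residueWeight vj k s d
    H = (L₁ ⊗ (oneMinus vj ^^ q)) ⊕ A
    residue-N : ⟪ N , W m s₀ ⟫ ≈ sign m * ct vj A d
    residue-N = begin
      ⟪ N , W m s₀ ⟫ ≈⟨ ≈-sym (residue-⊗-oneMinus^ vj q m s₀ d N) ⟩
      ⟪ N ⊗ (oneMinus vj ^^ q) , W (q ℕ.+ m) s₀ ⟫
        ≈⟨ pair-resp-≋ (N ⊗ (oneMinus vj ^^ q)) (H ⊗ (oneMinus vi ^^ m)) (W (q ℕ.+ m) s₀) N≋ ⟩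
      ⟪ H ⊗ (oneMinus vi ^^ m) , W (q ℕ.+ m) s₀ ⟫
        ≈⟨ ≈-reflexive (cong (λ k → ⟪ H ⊗ (oneMinus vi ^^ m) , W k s₀ ⟫) (ℕP.+-comm q m)) ⟩
      ⟪ H ⊗ (oneMinus vi ^^ m) , W (m ℕ.+ q) s₀ ⟫ ≈⟨ residueⱼ-⊗-oneMinusᵢ^ m q s₀ d H ⟩
      sign m * ⟪ H , W q (s₀ ℤ.+ + m) ⟫
        ≈⟨ *-congˡ (≈-reflexive (cong (λ s → ⟪ H , W q s ⟫) (ℤP.+-inverseˡ (+ m)))) ⟩
      sign m * ⟪ H , W q (+ 0) ⟫ ≈⟨ *-congˡ (residue-partial-fraction vj q d L₁ A deg) ⟩
      sign m * ct vj A d ∎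

  -- Existence: division with remainder by 1 - x_v/x_w

  Δ-+ : ∀ v g h e f → Δ v (λ x y → g x y + h x y) e f ≈ Δ v g e f + Δ v h e f
  Δ-+ v g h e f = [x+y]-[z+w]≈[x-z]+[y-w] _ _ _ _

  ==-move : ∀ a d e → (a == (e ℤ.- d)) ≡ ((a ℤ.+ d) == e)
  ==-move a d e = ==-cong-iff (λ a≡e-d → ≡.trans (cong (λ t → t ℤ.+ d) a≡e-d) (restore e d))
                          (λ a+d≡e → ≡.trans (≡.sym (cancel a d)) (cong (λ t → t ℤ.- d) a+d≡e))
    where
    restore : ∀ e d → (e ℤ.- d) ℤ.+ d ≡ e
    restore = ℤ-Solver.solve-∀
    cancel : ∀ a d → (a ℤ.+ d) ℤ.- d ≡ a
    cancel = ℤ-Solver.solve-∀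

  monomial-neg : ∀ r a b e f → monomial (- r) a b e f ≈ - monomial r a b e f
  monomial-neg r a b e f with (a == e) ∧ (b == f)
  ... | true = ≈-refl
  ... | false = ≈-sym -0#≈0#

  Δ-cons : ∀ v r a b Q e f → Δ v (coeff ((r , a , b) ∷ Q)) e f ≈
    (monomial r a b e f - monomial r (a ℤ.+ dirᵢ v) (b ℤ.+ dirⱼ v) e f) + Δ v (coeff Q) e f
  Δ-cons v r a b Q e f = ≈-trans ([x+y]-[z+w]≈[x-z]+[y-w] _ _ _ _)
    (+-congʳ (+-congˡ (-‿cong (≈-reflexive
      (cong₂ (λ x y → if x ∧ y then r else 0#) (==-move a (dirᵢ v) e) (==-move b (dirⱼ v) f))))))

  -- r x_i^a x_j^b = (1 - x_i/x_j) · quotient r a b + r x_j^(a+b)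
  quotient : Carrier → ℤ → ℤ → LP
  quotient r (+ zero) b = []
  quotient r (+ suc n) b = (- r , + n , b ℤ.+ + 1) ∷ quotient r (+ n) (b ℤ.+ + 1)
  quotient r -[1+ zero ] b = (r , -[1+ 0 ] , b) ∷ []
  quotient r -[1+ suc n ] b = (r , -[1+ suc n ] , b) ∷ quotient r -[1+ n ] (b ℤ.+ -[1+ 0 ])

  telescope : ∀ M X D Rm → X ≈ D + Rm → ((M - X) + D) + Rm ≈ M
  telescope M X D Rm X≈D+Rm = begin
    ((M - X) + D) + Rm ≈⟨ +-assoc _ _ _ ⟩
    (M - X) + (D + Rm) ≈⟨ +-congˡ (≈-sym X≈D+Rm) ⟩
    (M - X) + X ≈⟨ x-y+y≈x M X ⟩
    M ∎

  remainder-cong : ∀ r {b b′} e f → b ≡ b′ → monomial r (+ 0) b e f ≈ monomial r (+ 0) b′ e f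
  remainder-cong r e f refl = ≈-refl

  quotient-correct : ∀ r a b e f →
    monomial r a b e f ≈ Δ vi (coeff (quotient r a b)) e f + monomial r (+ 0) (a ℤ.+ b) e f
  quotient-correct r (+ zero) b e f = begin
    monomial r (+ 0) b e f ≈⟨ remainder-cong r e f (≡.sym (ℤP.+-identityˡ b)) ⟩
    monomial r (+ 0) (+ 0 ℤ.+ b) e f ≈⟨ ≈-sym (+-identityˡ _) ⟩
    0# + monomial r (+ 0) (+ 0 ℤ.+ b) e f ≈⟨ +-congʳ (≈-sym (x-x≈0 0#)) ⟩
    (0# - 0#) + monomial r (+ 0) (+ 0 ℤ.+ b) e f ∎
  quotient-correct r (+ suc n) b e f = ≈-sym (begin
    Δ vi (coeff ((- r , + n , b′) ∷ Q)) e f + Rm ≈⟨ +-congʳ (Δ-cons vi (- r) (+ n) b′ Q e f) ⟩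
    ((monomial (- r) (+ n) b′ e f - monomial (- r) a′ b″ e f) + Δ vi (coeff Q) e f) + Rm
      ≈⟨ +-congʳ (+-congʳ negated) ⟩
    ((monomial r a′ b″ e f - X) + Δ vi (coeff Q) e f) + Rm
      ≈⟨ telescope _ X _ Rm (X≈ (quotient-correct r (+ n) b′ e f)) ⟩
    monomial r a′ b″ e f
      ≈⟨ ≈-reflexive (cong₂ (λ x y → monomial r x y e f) (cong +_ (ℕP.+-comm n 1)) (unshift b)) ⟩
    monomial r (+ suc n) b e f ∎)
    where
    b′ = b ℤ.+ + 1
    a′ = + n ℤ.+ + 1
    b″ = b′ ℤ.+ -[1+ 0 ]
    Q = quotient r (+ n) b′
    X = monomial r (+ n) b′ e f
    Rm = monomial r (+ 0) (+ suc n ℤ.+ b) e f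
    regroup : ∀ x b → x ℤ.+ (b ℤ.+ + 1) ≡ (+ 1 ℤ.+ x) ℤ.+ b
    regroup = ℤ-Solver.solve-∀
    unshift : ∀ b → (b ℤ.+ + 1) ℤ.+ -[1+ 0 ] ≡ b
    unshift = ℤ-Solver.solve-∀
    negated : monomial (- r) (+ n) b′ e f - monomial (- r) a′ b″ e f ≈ monomial r a′ b″ e f - X
    negated = ≈-trans (+-cong (monomial-neg r (+ n) b′ e f) (-‿cong (monomial-neg r a′ b″ e f))) (-x--y≈y-x _ _)
    X≈ : X ≈ Δ vi (coeff Q) e f + monomial r (+ 0) (+ n ℤ.+ b′) e f → X ≈ Δ vi (coeff Q) e f + Rm
    X≈ IH = ≈-trans IH (+-congˡ (remainder-cong r e f (regroup (+ n) b)))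
  quotient-correct r -[1+ zero ] b e f = ≈-sym (begin
    Δ vi (coeff ((r , -[1+ 0 ] , b) ∷ [])) e f + Rm ≈⟨ +-congʳ (Δ-cons vi r -[1+ 0 ] b [] e f) ⟩
    ((monomial r -[1+ 0 ] b e f - X) + (0# - 0#)) + Rm ≈⟨ telescope _ X _ Rm X≈ ⟩
    monomial r -[1+ 0 ] b e f ∎)
    where
    X = monomial r (+ 0) (b ℤ.+ -[1+ 0 ]) e f
    Rm = monomial r (+ 0) (-[1+ 0 ] ℤ.+ b) e f
    X≈ : X ≈ (0# - 0#) + Rm
    X≈ = ≈-trans (remainder-cong r e f (ℤP.+-comm b -[1+ 0 ]))
                 (≈-sym (≈-trans (+-congʳ (x-x≈0 0#)) (+-identityˡ _)))
  quotient-correct r -[1+ suc n ] b e f = ≈-sym (begin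
    Δ vi (coeff ((r , -[1+ suc n ] , b) ∷ Q)) e f + Rm ≈⟨ +-congʳ (Δ-cons vi r -[1+ suc n ] b Q e f) ⟩
    ((monomial r -[1+ suc n ] b e f - X) + Δ vi (coeff Q) e f) + Rm
      ≈⟨ telescope _ X _ Rm (X≈ (quotient-correct r -[1+ n ] b″ e f)) ⟩
    monomial r -[1+ suc n ] b e f ∎)
    where
    b″ = b ℤ.+ -[1+ 0 ]
    Q = quotient r -[1+ n ] b″
    X = monomial r -[1+ n ] b″ e f
    Rm = monomial r (+ 0) (-[1+ suc n ] ℤ.+ b) e f
    reassociate : ∀ x b → x ℤ.+ (b ℤ.+ -[1+ 0 ]) ≡ (x ℤ.+ -[1+ 0 ]) ℤ.+ b
    reassociate = ℤ-Solver.solve-∀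
    regroup : -[1+ n ] ℤ.+ b″ ≡ -[1+ suc n ] ℤ.+ b
    regroup = ≡.trans (reassociate -[1+ n ] b) (cong (λ k → -[1+ suc k ] ℤ.+ b) (ℕP.+-identityʳ n))
    X≈ : X ≈ Δ vi (coeff Q) e f + monomial r (+ 0) (-[1+ n ] ℤ.+ b″) e f → X ≈ Δ vi (coeff Q) e f + Rm
    X≈ IH = ≈-trans IH (+-congˡ (remainder-cong r e f regroup))

  quotientᵢ : LP → LP
  quotientᵢ [] = []
  quotientᵢ ((r , a , b) ∷ N) = quotient r a b ++ quotientᵢ N

  remainderᵢ : LP → LP
  remainderᵢ [] = []
  remainderᵢ ((r , a , b) ∷ N) = (r , + 0 , a ℤ.+ b) ∷ remainderᵢ N

  divisionᵢ : ∀ N e f → coeff N e f ≈ Δ vi (coeff (quotientᵢ N)) e f + coeff (remainderᵢ N) e f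
  divisionᵢ [] e f = ≈-sym (≈-trans (+-congʳ (x-x≈0 0#)) 0+0≈0)
  divisionᵢ ((r , a , b) ∷ N) e f = begin
    monomial r a b e f + coeff N e f ≈⟨ +-cong (quotient-correct r a b e f) (divisionᵢ N e f) ⟩
    (Δ vi (coeff (quotient r a b)) e f + monomial r (+ 0) (a ℤ.+ b) e f) +
      (Δ vi (coeff (quotientᵢ N)) e f + coeff (remainderᵢ N) e f) ≈⟨ [x+y]+[z+w]≈[x+z]+[y+w] _ _ _ _ ⟩
    (Δ vi (coeff Q) e f + Δ vi (coeff (quotientᵢ N)) e f) + coeff (remainderᵢ ((r , a , b) ∷ N)) e f
      ≈⟨ +-congʳ (≈-sym (≈-trans (Δ-cong vi (coeff-++ Q (quotientᵢ N)) e f)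
                                 (Δ-+ vi (coeff Q) (coeff (quotientᵢ N)) e f))) ⟩
    Δ vi (coeff (quotientᵢ ((r , a , b) ∷ N))) e f + coeff (remainderᵢ ((r , a , b) ∷ N)) e f ∎
    where Q = quotient r a b

  remainderᵢ-free : ∀ N e f → e ≢ + 0 → coeff (remainderᵢ N) e f ≈ 0#
  remainderᵢ-free [] e f _ = ≈-refl
  remainderᵢ-free ((r , a , b) ∷ N) e f e≢0 rewrite ==-false (λ 0≡e → e≢0 (≡.sym 0≡e)) =
    ≈-trans (+-identityˡ _) (remainderᵢ-free N e f e≢0)

  swap : LP → LP
  swap = map λ { (r , a , b) → (r , b , a) }

  coeff-swap : ∀ p e f → coeff (swap p) e f ≈ coeff p f e
  coeff-swap [] e f = ≈-refl
  coeff-swap ((r , a , b) ∷ p) e f =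
    +-cong (≈-reflexive (cong (λ t → if t then r else 0#) (BoolP.∧-comm (b == e) (a == f)))) (coeff-swap p e f)

  Division : Var → LP → Set (c ⊔ ℓ)
  Division v N = Σ LP λ Q → Σ LP λ R₀ →
    (∀ e f → coeff N e f ≈ Δ v (coeff Q) e f + coeff R₀ e f) ×
    (∀ e f → expOf v e f ≢ + 0 → coeff R₀ e f ≈ 0#)

  divide : ∀ v N → Division v N
  divide vi N = quotientᵢ N , remainderᵢ N , divisionᵢ N , remainderᵢ-free N
  divide vj N = swap Q , swap R₀ , division , free
    where
    Q = quotientᵢ (swap N)
    R₀ = remainderᵢ (swap N)
    division : ∀ e f → coeff N e f ≈ Δ vj (coeff (swap Q)) e f + coeff (swap R₀) e f
    division e f = begin
      coeff N e f ≈⟨ ≈-sym (coeff-swap N f e) ⟩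
      coeff (swap N) f e ≈⟨ divisionᵢ (swap N) f e ⟩
      Δ vi (coeff Q) f e + coeff R₀ f e
        ≈⟨ ≈-sym (+-cong (+-cong (coeff-swap Q e f) (-‿cong (coeff-swap Q _ _))) (coeff-swap R₀ e f)) ⟩
      Δ vj (coeff (swap Q)) e f + coeff (swap R₀) e f ∎
    free : ∀ e f → f ≢ + 0 → coeff (swap R₀) e f ≈ 0#
    free e f f≢0 = ≈-trans (coeff-swap R₀ e f) (remainderᵢ-free (swap N) f e f≢0)

  out-of-range-shrink : ∀ x m → ¬ InRange x (suc m) → ¬ InRange x m
  out-of-range-shrink x m out (0≤x , x<m) = out (0≤x , ℤP.<-trans x<m (ℤ.+<+ (ℕP.n<1+n m)))

  out-of-range-pred : ∀ x m → ¬ InRange x (suc m) → ¬ InRange (x ℤ.- + 1) m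
  out-of-range-pred (+ zero) m out (() , _)
  out-of-range-pred (+ suc n) m out (_ , ℤ.+<+ n<m) = out (ℤ.+≤+ z≤n , ℤ.+<+ (s≤s n<m))
  out-of-range-pred -[1+ n ] m out (() , _)

  out-of-range-≢0 : ∀ x m → ¬ InRange x (suc m) → x ≢ + 0
  out-of-range-≢0 .(+ 0) m out refl = out (ℤ.+≤+ z≤n , ℤ.+<+ (s≤s z≤n))

  Δ-exponent : ∀ v e f → expOf v (e ℤ.- dirᵢ v) (f ℤ.- dirⱼ v) ≡ expOf v e f ℤ.- + 1
  Δ-exponent vi e f = refl
  Δ-exponent vj e f = refl

  Δ-degree : ∀ v A m → IsPolyDegLt v A m → ∀ e f → ¬ InRange (expOf v e f) (suc m) → Δ v (coeff A) e f ≈ 0#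
  Δ-degree v A m deg e f out =
    ≈-trans (+-cong (deg e f (out-of-range-shrink _ m out)) (-‿cong (deg _ _ shifted-out))) (x-x≈0 0#)
    where
    shifted-out : ¬ InRange (expOf v (e ℤ.- dirᵢ v) (f ℤ.- dirⱼ v)) m
    shifted-out = ≡.subst (λ t → ¬ InRange t m) (≡.sym (Δ-exponent v e f)) (out-of-range-pred _ m out)

  -- N = (1 - x_v/x_w)^m L₁ + A with A of degree < m in x_v
  Expansion : Var → ℕ → LP → Set (c ⊔ ℓ)
  Expansion v m N = Σ LP λ L₁ → Σ LP λ A →
    (∀ e f → coeff N e f ≈ Δ^ v m (coeff L₁) e f + coeff A e f) × IsPolyDegLt v A m

  expansion : ∀ v m N → Expansion v m N
  expansion v zero N = N , [] , (λ e f → ≈-sym (+-identityʳ _)) , (λ e f _ → ≈-refl)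
  expansion v (suc m) N with divide v N
  ... | Q , R₀ , N≈ , R₀-free with expansion v m Q
  ...   | L₁ , A , Q≈ , deg = L₁ , (oneMinus v ⊗ A) ++ R₀ , N≈′ , deg′
    where
    coeff-remainder : ∀ e f → coeff ((oneMinus v ⊗ A) ++ R₀) e f ≈ Δ v (coeff A) e f + coeff R₀ e f
    coeff-remainder e f = ≈-trans (coeff-++ (oneMinus v ⊗ A) R₀ e f) (+-congʳ (coeff-oneMinus-⊗ v A e f))
    N≈′ : ∀ e f → coeff N e f ≈ Δ^ v (suc m) (coeff L₁) e f + coeff ((oneMinus v ⊗ A) ++ R₀) e f
    N≈′ e f = begin
      coeff N e f ≈⟨ N≈ e f ⟩
      Δ v (coeff Q) e f + coeff R₀ e f
        ≈⟨ +-congʳ (≈-trans (Δ-cong v Q≈ e f) (Δ-+ v (Δ^ v m (coeff L₁)) (coeff A) e f)) ⟩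
      (Δ^ v (suc m) (coeff L₁) e f + Δ v (coeff A) e f) + coeff R₀ e f ≈⟨ +-assoc _ _ _ ⟩
      Δ^ v (suc m) (coeff L₁) e f + (Δ v (coeff A) e f + coeff R₀ e f)
        ≈⟨ +-congˡ (≈-sym (coeff-remainder e f)) ⟩
      Δ^ v (suc m) (coeff L₁) e f + coeff ((oneMinus v ⊗ A) ++ R₀) e f ∎
    deg′ : IsPolyDegLt v ((oneMinus v ⊗ A) ++ R₀) (suc m)
    deg′ e f out = ≈-trans (coeff-remainder e f)
      (≈-trans (+-cong (Δ-degree v A m deg e f out) (R₀-free e f (out-of-range-≢0 _ m out))) 0+0≈0)

  -- -x_j/x_i, the factor with  (-x_j/x_i)(1 - x_i/x_j) = 1 - x_j/x_i
  twist : LP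
  twist = (- 1# , -[1+ 0 ] , + 1) ∷ []

  twisted : ℕ → LP → LP
  twisted zero N = N
  twisted (suc k) N = twisted k (twist ⊗ N)

  Δᵢ-twist : ∀ N → Δ vi (coeff (twist ⊗ N)) ≐ Δ vj (coeff N)
  Δᵢ-twist N e f = begin
    coeff (twist ⊗ N) e f - coeff (twist ⊗ N) (e ℤ.- + 1) (f ℤ.- -[1+ 0 ])
      ≈⟨ +-cong (coeff-twist-⊗ e f)
                (-‿cong (≈-trans (coeff-twist-⊗ _ _)
                                 (-‿cong (≈-reflexive (cong₂ (coeff N) (e-1+1≡e e) (f+1-1≡f f)))))) ⟩
    - coeff N (e ℤ.+ + 1) (f ℤ.+ -[1+ 0 ]) - - coeff N e f ≈⟨ -x--y≈y-x _ _ ⟩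
    Δ vj (coeff N) e f ∎
    where
    coeff-twist-⊗ : ∀ e f → coeff (twist ⊗ N) e f ≈ - coeff N (e ℤ.+ + 1) (f ℤ.+ -[1+ 0 ])
    coeff-twist-⊗ e f = ≈-trans (coeff-monomial-⊗ (- 1#) -[1+ 0 ] (+ 1) N e f) (-1*x≈-x _)
    e-1+1≡e : ∀ e → (e ℤ.+ -[1+ 0 ]) ℤ.+ + 1 ≡ e
    e-1+1≡e = ℤ-Solver.solve-∀
    f+1-1≡f : ∀ f → (f ℤ.+ + 1) ℤ.+ -[1+ 0 ] ≡ f
    f+1-1≡f = ℤ-Solver.solve-∀

  Δ-comm : ∀ u v g → Δ u (Δ v g) ≐ Δ v (Δ u g)
  Δ-comm u v g e f = ≈-trans ([x-y]-[z-w]≈[x-z]-[y-w] _ _ _ _)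
    (+-congˡ (-‿cong (+-congˡ (-‿cong (≈-reflexive
      (cong₂ g (exchange e (dirᵢ u) (dirᵢ v)) (exchange f (dirⱼ u) (dirⱼ v))))))))
    where
    exchange : ∀ x a b → (x ℤ.- a) ℤ.- b ≡ (x ℤ.- b) ℤ.- a
    exchange = ℤ-Solver.solve-∀

  Δ-Δ^-comm : ∀ u v k g → Δ u (Δ^ v k g) ≐ Δ^ v k (Δ u g)
  Δ-Δ^-comm u v zero g e f = ≈-refl
  Δ-Δ^-comm u v (suc k) g e f = ≈-trans (Δ-comm u v (Δ^ v k g) e f) (Δ-cong v (Δ-Δ^-comm u v k g) e f)

  Δᵢ^-twisted : ∀ k N → Δ^ vi k (coeff (twisted k N)) ≐ Δ^ vj k (coeff N)
  Δᵢ^-twisted zero N e f = ≈-refl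
  Δᵢ^-twisted (suc k) N e f = begin
    Δ vi (Δ^ vi k (coeff (twisted k (twist ⊗ N)))) e f ≈⟨ Δ-cong vi (Δᵢ^-twisted k (twist ⊗ N)) e f ⟩
    Δ vi (Δ^ vj k (coeff (twist ⊗ N))) e f ≈⟨ Δ-Δ^-comm vi vj k (coeff (twist ⊗ N)) e f ⟩
    Δ^ vj k (Δ vi (coeff (twist ⊗ N))) e f ≈⟨ Δ^-cong vj k (Δᵢ-twist N) e f ⟩
    Δ^ vj k (Δ vj (coeff N)) e f ≈⟨ ≈-sym (Δ-Δ^-comm vj vj k (coeff N) e f) ⟩
    Δ vj (Δ^ vj k (coeff N)) e f ∎

  coeff-expansion : ∀ v k L₁ A e f →
    coeff ((L₁ ⊗ (oneMinus v ^^ k)) ⊕ A) e f ≈ Δ^ v k (coeff L₁) e f + coeff A e f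
  coeff-expansion v k L₁ A e f =
    ≈-trans (coeff-++ (L₁ ⊗ (oneMinus v ^^ k)) A e f) (+-congʳ (coeff-⊗-oneMinus^ v k L₁ e f))

  hasPartialFractionᵢ : ∀ L m → HasPartialFraction vi L m
  hasPartialFractionᵢ L m with expansion vi m L
  ... | L₁ , A , L≈ , deg = L₁ , A , m , deg , identity
    where
    H = (L₁ ⊗ (oneMinus vi ^^ m)) ⊕ A
    identity : (L ⊗ (oneMinus vi ^^ m)) ≋ (H ⊗ (oneMinus vi ^^ m))
    identity e f = begin
      coeff (L ⊗ (oneMinus vi ^^ m)) e f ≈⟨ coeff-⊗-oneMinus^ vi m L e f ⟩
      Δ^ vi m (coeff L) e f
        ≈⟨ Δ^-cong vi m (λ x y → ≈-trans (L≈ x y) (≈-sym (coeff-expansion vi m L₁ A x y))) e f ⟩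
      Δ^ vi m (coeff H) e f ≈⟨ ≈-sym (coeff-⊗-oneMinus^ vi m H e f) ⟩
      coeff (H ⊗ (oneMinus vi ^^ m)) e f ∎

  hasPartialFractionⱼ : ∀ L m → HasPartialFraction vj L m
  hasPartialFractionⱼ L m with expansion vj m (twisted m L)
  ... | L₁ , A , L≈ , deg = L₁ , A , m , deg , identity
    where
    H = (L₁ ⊗ (oneMinus vj ^^ m)) ⊕ A
    identity : (L ⊗ (oneMinus vj ^^ m)) ≋ (H ⊗ (oneMinus vi ^^ m))
    identity e f = begin
      coeff (L ⊗ (oneMinus vj ^^ m)) e f ≈⟨ coeff-⊗-oneMinus^ vj m L e f ⟩
      Δ^ vj m (coeff L) e f ≈⟨ ≈-sym (Δᵢ^-twisted m L e f) ⟩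
      Δ^ vi m (coeff (twisted m L)) e f
        ≈⟨ Δ^-cong vi m (λ x y → ≈-trans (L≈ x y) (≈-sym (coeff-expansion vj m L₁ A x y))) e f ⟩
      Δ^ vi m (coeff H) e f ≈⟨ ≈-sym (coeff-⊗-oneMinus^ vi m H e f) ⟩
      coeff (H ⊗ (oneMinus vi ^^ m)) e f ∎

mainTheorem8 : ∀ {c ℓ} (R : CommutativeRing c ℓ) → let open LaurentPoly R in
    (L : LP) (m : ℕ) → IsHomogeneousDeg0 L →
      Σ (CommutativeRing.Carrier R) λ κ →
        HasPartialFraction vi L m × HasPartialFraction vj L m ×
        BracketIs vi L m (const κ) × BracketIs vj L m (const (CommutativeRing.-_ R κ))
mainTheorem8 R L m hom = κ , hasPartialFractionᵢ L m , hasPartialFractionⱼ L m , bracketᵢ , bracketⱼ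
  where
  open CommutativeRing R using (-_; *-congˡ; zeroʳ; trans)
  open LaurentPoly R
  open PartialFractions R
  κ = ⟪ L , residueWeight vi m (+ 0) (+ 0) ⟫
  bracketᵢ : BracketIs vi L m (const κ)
  bracketᵢ L₁ A q pf f with f ℤ.≟ + 0
  ... | yes refl = bracketᵢ-unique L m L₁ A q pf (+ 0)
  ... | no f≢0 = trans (bracketᵢ-unique L m L₁ A q pf f) (residue-homogeneous vi m (+ 0) f L hom f≢0)
  bracketⱼ : BracketIs vj L m (const (- κ))
  bracketⱼ L₁ A q pf f with f ℤ.≟ + 0
  ... | yes refl = trans (bracketⱼ-unique L m L₁ A q pf (+ 0)) (residue-reflection m L)
  ... | no f≢0 = trans (bracketⱼ-unique L m L₁ A q pf f)
                       (trans (*-congˡ (residue-homogeneous vj m _ f L hom f≢0)) (zeroʳ _))
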